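{- Let $f$ be an AC symbol that is also idempotent ($f(x,x)=x$), and let $R_S$ be a finite set of rewrite rules between $f$-monomials over a finite set $C$ of constants such that no $f$-monomial occurring in a rule of $R_S$ contains a repeated constant. Let $\rightarrow$ be the union of $\rightarrow_{R_S}$ with the idempotency rewriting $f(M)\rightarrow f(M-\{\!\{a\}\!\})$ (for any constant $a$ occurring at least twice in $M$). Then $\rightarrow$ is locally confluent if and only if (i) for every pair of distinct rules $f(A_1)\rightarrow f(A_2)$, $f(B_1)\rightarrow f(B_2)$ in $R_S$, the critical pair $(f((AB-A_1)\cup A_2), f((AB-B_1)\cup B_2))$ with $AB=(A_1\cup B_1)-(A_1\cap B_1)$ is joinable, and (ii) for every rule $f(M)\rightarrow f(N)\in R_S$ and every constant $a\in M$, the pair $(f(M), f(N\cup\{\!\{a\}\!\}))$ is joinable; joinability being with respect to $\rightarrow$.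
   Context: $f$-monomials: $f(M)$ with $M$ a nonempty finite multiset of constants; a constant $c$ is identified with $f(\{\!\{c\}\!\})$. On multisets $\cup$ is multiset sum, $\cap$ multiset intersection (min of multiplicities), $-$ truncated multiset difference, $\subseteq$ sub-multiset. A rule $f(A)\rightarrow f(B)$ rewrites $f(M)$ to $f((M-A)\cup B)$ when $A\subseteq M$. A relation is locally confluent if any two one-step reducts of a term have a common reduct; a pair is joinable if both components reduce (in zero or more steps) to a common term. -}

module Defs where

open import Data.Nat using (ℕ; zero; suc; _+_; _∸_; _⊓_; _≤_; _<_)
open import Data.Fin using (Fin; _≟_)
open import Data.Vec using (Vec; zipWith; tabulate; lookup)
open import Data.Vec.Relation.Binary.Pointwise.Inductive using (Pointwise)
open import Data.Vec.Relation.Unary.All using (All)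
open import Data.Vec.Relation.Unary.Any using (Any)
open import Data.List using (List)
open import Data.List.Membership.Propositional using (_∈_)
open import Data.Product using (_×_; _,_; ∃)
open import Data.Bool using (if_then_else_)
open import Relation.Nullary.Decidable using (⌊_⌋)
open import Relation.Nullary using (¬_)
open import Relation.Binary.PropositionalEquality using (_≡_)
open import Relation.Binary.Construct.Closure.ReflexiveTransitive using (Star)

-- Finite multisets over the finite constant set C = Fin n,
-- represented by their multiplicity vectors.
Multiset : ℕ → Set
Multiset n = Vec ℕ n

module _ {n : ℕ} where

  _∪ₘ_ : Multiset n → Multiset n → Multiset n
  _∪ₘ_ = zipWith _+_

  _∩ₘ_ : Multiset n → Multiset n → Multiset n
  _∩ₘ_ = zipWith _⊓_

  _−ₘ_ : Multiset n → Multiset n → Multiset n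
  _−ₘ_ = zipWith _∸_

  _⊆ₘ_ : Multiset n → Multiset n → Set
  A ⊆ₘ B = Pointwise _≤_ A B

  ⟦_⟧ : Fin n → Multiset n
  ⟦ a ⟧ = tabulate (λ j → if ⌊ j ≟ a ⌋ then 1 else 0)

  _∈ₘ_ : Fin n → Multiset n → Set
  a ∈ₘ M = 1 ≤ lookup M a

  NonEmpty : Multiset n → Set
  NonEmpty M = Any (λ k → 1 ≤ k) M

  NoRepeat : Multiset n → Set
  NoRepeat M = All (λ k → k ≤ 1) M

-- A rule f(A) → f(B) is a pair (A , B); R_S is a finite list of rules.
Rule : ℕ → Set
Rule n = Multiset n × Multiset n

Rules : ℕ → Set
Rules n = List (Rule n)

WellFormed : ∀ {n} → Rules n → Set
WellFormed {n} R = ∀ (A B : Multiset n) → (A , B) ∈ R →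
  (NonEmpty A × NoRepeat A) × (NonEmpty B × NoRepeat B)

-- The relation → = →_{R_S} ∪ idempotency, on f-monomials f(M)
-- (represented by M).
data Step {n : ℕ} (R : Rules n) : Multiset n → Multiset n → Set where
  rule : ∀ {A B M} → (A , B) ∈ R → A ⊆ₘ M →
         Step R M ((M −ₘ A) ∪ₘ B)
  idem : ∀ {M} (a : Fin n) → 2 ≤ lookup M a →
         Step R M (M −ₘ ⟦ a ⟧)

Steps : ∀ {n} → Rules n → Multiset n → Multiset n → Set
Steps R = Star (Step R)

Joinable : ∀ {n} → Rules n → Multiset n → Multiset n → Set
Joinable {n} R M N = ∃ λ (P : Multiset n) → Steps R M P × Steps R N P

LocallyConfluent : ∀ {n} → Rules n → Set
LocallyConfluent {n} R = ∀ (M : Multiset n) → NonEmpty M →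
  ∀ (N₁ N₂ : Multiset n) → Step R M N₁ → Step R M N₂ → Joinable R N₁ N₂

CriticalPairsJoinable : ∀ {n} → Rules n → Set
CriticalPairsJoinable {n} R = ∀ (A₁ A₂ B₁ B₂ : Multiset n) →
  (A₁ , A₂) ∈ R → (B₁ , B₂) ∈ R → ¬ ((A₁ , A₂) ≡ (B₁ , B₂)) →
  let AB = (A₁ ∪ₘ B₁) −ₘ (A₁ ∩ₘ B₁) in
  Joinable R ((AB −ₘ A₁) ∪ₘ A₂) ((AB −ₘ B₁) ∪ₘ B₂)

IdemPairsJoinable : ∀ {n} → Rules n → Set
IdemPairsJoinable {n} R = ∀ (M N : Multiset n) → (M , N) ∈ R →
  ∀ (a : Fin n) → a ∈ₘ M → Joinable R M (N ∪ₘ ⟦ a ⟧)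

-- Since f(P) → f(Q) implies f(P ∪ K) → f(Q ∪ K), a joinable pair stays
-- joinable in any context K. A peak of two rule steps is then a critical pair
-- placed in the context M − AB, where AB is the least multiset containing both
-- left-hand sides. A rule step f(A) → f(B) and an idempotency step at a commute
-- unless a occurs in A; since A has no repeated constant, a then occurs exactly
-- once in A and at least twice in M, so the peak is the pair (f(A), f(B ∪ {{a}}))
-- of condition (ii) placed in the context M − {{a}} − A. Two idempotency steps
-- always commute. Conversely, the pairs in (i) and (ii) are the peaks at f(AB)
-- and at f(M ∪ {{a}}).
module Submission where

open import Data.Bool using (if_then_else_)
open import Data.Fin using (Fin; _≟_)
open import Data.List.Membership.Propositional using (_∈_)
import Data.Nat as ℕ
open import Data.Nat using (ℕ; _+_; _∸_; _⊓_; _⊔_; _≤_; _<_; z≤n; s≤s)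
open import Data.Nat.Properties hiding (_≟_)
open import Data.Product using (_×_; _,_; proj₁; proj₂)
import Data.Product.Properties as Product
open import Data.Sum using (_⊎_; inj₁; inj₂)
open import Data.Vec using ([]; _∷_; lookup)
import Data.Vec.Properties as Vec
open import Data.Vec.Relation.Binary.Pointwise.Inductive as Pointwise using ([]; _∷_)
open import Data.Vec.Relation.Unary.All.Properties using (lookup⁺)
open import Data.Vec.Relation.Unary.Any using (here; there)
open import Function.Base using (_∘_)
open import Function.Bundles using (_⇔_; mk⇔)
open import Relation.Binary.Construct.Closure.ReflexiveTransitive using (ε; _◅_; gmap)
open import Relation.Binary.PropositionalEquality
open import Relation.Nullary using (does; yes; no)
open import Relation.Nullary.Decidable using (isYes≗does; dec-true; dec-false)
open import Defs

m+n∸m⊓n≡m⊔n : ∀ m n → m + n ∸ m ⊓ n ≡ m ⊔ n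
m+n∸m⊓n≡m⊔n m n with ≤-total m n
... | inj₁ m≤n rewrite m≤n⇒m⊓n≡m m≤n | m≤n⇒m⊔n≡n m≤n = m+n∸m≡n m n
... | inj₂ n≤m rewrite m≥n⇒m⊓n≡n n≤m | m≥n⇒m⊔n≡m n≤m = m+n∸n≡m m n

[n∸m]+[o∸n]≡o∸m : ∀ {m n o} → m ≤ n → n ≤ o → (n ∸ m) + (o ∸ n) ≡ o ∸ m
[n∸m]+[o∸n]≡o∸m {m} {n} {o} m≤n n≤o = begin
  (n ∸ m) + (o ∸ n)  ≡⟨ +-comm (n ∸ m) (o ∸ n) ⟩
  (o ∸ n) + (n ∸ m)  ≡⟨ +-∸-assoc (o ∸ n) m≤n ⟨
  (o ∸ n) + n ∸ m    ≡⟨ cong (_∸ m) (m∸n+n≡m n≤o) ⟩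
  o ∸ m              ∎
  where open ≡-Reasoning

[m∸n]∸o≡[m∸o]∸n : ∀ m n o → m ∸ n ∸ o ≡ m ∸ o ∸ n
[m∸n]∸o≡[m∸o]∸n m n o = begin
  m ∸ n ∸ o    ≡⟨ ∸-+-assoc m n o ⟩
  m ∸ (n + o)  ≡⟨ cong (m ∸_) (+-comm n o) ⟩
  m ∸ (o + n)  ≡⟨ ∸-+-assoc m o n ⟨
  m ∸ o ∸ n    ∎
  where open ≡-Reasoning

private
  variable
    n : ℕ
    a b : Fin n
    A B M N X : Multiset n

_[_↦_] : Multiset n → Multiset n → Multiset n → Multiset n
M [ A ↦ B ] = (M −ₘ A) ∪ₘ B

-- The multiset AB of condition (i); by m+n∸m⊓n≡m⊔n it is the pointwise maximum.
infix 25 _⊔ₘ_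
_⊔ₘ_ : Multiset n → Multiset n → Multiset n
A ⊔ₘ B = (A ∪ₘ B) −ₘ (A ∩ₘ B)

⊆ₘ-lookup⁻ : (∀ i → lookup A i ≤ lookup M i) → A ⊆ₘ M
⊆ₘ-lookup⁻ {A = A} {M = M} A≤M =
  subst₂ _⊆ₘ_ (Vec.tabulate∘lookup A) (Vec.tabulate∘lookup M) (Pointwise.tabulate⁺ A≤M)

⊆ₘ-trans : A ⊆ₘ X → X ⊆ₘ M → A ⊆ₘ M
⊆ₘ-trans = Pointwise.trans ≤-trans

lookup-∪ₘ : ∀ (M N : Multiset n) i → lookup (M ∪ₘ N) i ≡ lookup M i + lookup N i
lookup-∪ₘ M N i = Vec.lookup-zipWith _+_ i M N

lookup-−ₘ : ∀ (M N : Multiset n) i → lookup (M −ₘ N) i ≡ lookup M i ∸ lookup N i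
lookup-−ₘ M N i = Vec.lookup-zipWith _∸_ i M N

lookup-⟦⟧ : ∀ (a i : Fin n) → lookup ⟦ a ⟧ i ≡ (if does (i ≟ a) then 1 else 0)
lookup-⟦⟧ a i = trans (Vec.lookup∘tabulate _ i) (cong (λ c → if c then 1 else 0) (isYes≗does (i ≟ a)))

lookup-⟦⟧-≡ : ∀ (a : Fin n) → lookup ⟦ a ⟧ a ≡ 1
lookup-⟦⟧-≡ a = trans (lookup-⟦⟧ a a) (cong (λ c → if c then 1 else 0) (dec-true (a ≟ a) refl))

lookup-⟦⟧-≢ : ∀ {i : Fin n} → i ≢ a → lookup ⟦ a ⟧ i ≡ 0
lookup-⟦⟧-≢ {a = a} {i} i≢a =
  trans (lookup-⟦⟧ a i) (cong (λ c → if c then 1 else 0) (dec-false (i ≟ a) i≢a))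

lookup-−ₘ-⟦⟧-≢ : ∀ {i : Fin n} → i ≢ a → lookup (M −ₘ ⟦ a ⟧) i ≡ lookup M i
lookup-−ₘ-⟦⟧-≢ {a = a} {M = M} {i} i≢a =
  trans (lookup-−ₘ M ⟦ a ⟧ i) (cong (lookup M i ∸_) (lookup-⟦⟧-≢ i≢a))

∪ₘ-comm : ∀ (M N : Multiset n) → M ∪ₘ N ≡ N ∪ₘ M
∪ₘ-comm = Vec.zipWith-comm +-comm

∪ₘ-assoc : ∀ (M N K : Multiset n) → (M ∪ₘ N) ∪ₘ K ≡ M ∪ₘ (N ∪ₘ K)
∪ₘ-assoc = Vec.zipWith-assoc +-assoc

−ₘ-swap : ∀ (M A B : Multiset n) → (M −ₘ A) −ₘ B ≡ (M −ₘ B) −ₘ A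
−ₘ-swap []      []      []      = refl
−ₘ-swap (m ∷ M) (x ∷ A) (y ∷ B) = cong₂ _∷_ ([m∸n]∸o≡[m∸o]∸n m x y) (−ₘ-swap M A B)

∪ₘ-−ₘ-cancelˡ : ∀ (M N : Multiset n) → (M ∪ₘ N) −ₘ M ≡ N
∪ₘ-−ₘ-cancelˡ []      []      = refl
∪ₘ-−ₘ-cancelˡ (m ∷ M) (k ∷ N) = cong₂ _∷_ (m+n∸m≡n m k) (∪ₘ-−ₘ-cancelˡ M N)

∪ₘ-−ₘ-cancelʳ : ∀ (M N : Multiset n) → (M ∪ₘ N) −ₘ N ≡ M
∪ₘ-−ₘ-cancelʳ []      []      = refl
∪ₘ-−ₘ-cancelʳ (m ∷ M) (k ∷ N) = cong₂ _∷_ (m+n∸n≡m m k) (∪ₘ-−ₘ-cancelʳ M N)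

M⊆ₘM∪ₘN : ∀ (M N : Multiset n) → M ⊆ₘ (M ∪ₘ N)
M⊆ₘM∪ₘN []      []      = []
M⊆ₘM∪ₘN (m ∷ M) (k ∷ N) = m≤m+n m k ∷ M⊆ₘM∪ₘN M N

∪ₘ-−ₘ-comm : ∀ K → A ⊆ₘ M → (M ∪ₘ K) −ₘ A ≡ (M −ₘ A) ∪ₘ K
∪ₘ-−ₘ-comm []      []            = refl
∪ₘ-−ₘ-comm (k ∷ K) (x≤m ∷ A⊆M) = cong₂ _∷_ (+-∸-comm k x≤m) (∪ₘ-−ₘ-comm K A⊆M)

A∪ₘ[M−ₘA]≡M : A ⊆ₘ M → A ∪ₘ (M −ₘ A) ≡ M
A∪ₘ[M−ₘA]≡M []            = refl
A∪ₘ[M−ₘA]≡M (x≤m ∷ A⊆M) = cong₂ _∷_ (m+[n∸m]≡n x≤m) (A∪ₘ[M−ₘA]≡M A⊆M)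

[X−ₘA]∪ₘ[M−ₘX]≡M−ₘA : A ⊆ₘ X → X ⊆ₘ M → (X −ₘ A) ∪ₘ (M −ₘ X) ≡ M −ₘ A
[X−ₘA]∪ₘ[M−ₘX]≡M−ₘA []            []            = refl
[X−ₘA]∪ₘ[M−ₘX]≡M−ₘA (a≤x ∷ A⊆X) (x≤m ∷ X⊆M) =
  cong₂ _∷_ ([n∸m]+[o∸n]≡o∸m a≤x x≤m) ([X−ₘA]∪ₘ[M−ₘX]≡M−ₘA A⊆X X⊆M)

∪ₘ-⊆ₘ⇒⊆ₘ-−ₘ : (A ∪ₘ B) ⊆ₘ M → A ⊆ₘ (M −ₘ B)
∪ₘ-⊆ₘ⇒⊆ₘ-−ₘ {A = []}    {B = []}    [] = []
∪ₘ-⊆ₘ⇒⊆ₘ-−ₘ {A = x ∷ A} {B = y ∷ B} (x+y≤m ∷ A∪B⊆M) =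
  m+n≤o⇒m≤o∸n x x+y≤m ∷ ∪ₘ-⊆ₘ⇒⊆ₘ-−ₘ A∪B⊆M

∪ₘ-⊆ₘ⇒⊆ₘ-−ₘ′ : (A ∪ₘ B) ⊆ₘ M → B ⊆ₘ (M −ₘ A)
∪ₘ-⊆ₘ⇒⊆ₘ-−ₘ′ {A = A} {B = B} A∪B⊆M = ∪ₘ-⊆ₘ⇒⊆ₘ-−ₘ (subst (_⊆ₘ _) (∪ₘ-comm A B) A∪B⊆M)

reduct-∪ₘ-complement : A ⊆ₘ X → X ⊆ₘ M → (X [ A ↦ B ]) ∪ₘ (M −ₘ X) ≡ M [ A ↦ B ]
reduct-∪ₘ-complement {A = A} {X = X} {M = M} {B = B} A⊆X X⊆M = begin
  ((X −ₘ A) ∪ₘ B) ∪ₘ (M −ₘ X)   ≡⟨ ∪ₘ-assoc (X −ₘ A) B (M −ₘ X) ⟩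
  (X −ₘ A) ∪ₘ (B ∪ₘ (M −ₘ X))   ≡⟨ cong ((X −ₘ A) ∪ₘ_) (∪ₘ-comm B (M −ₘ X)) ⟩
  (X −ₘ A) ∪ₘ ((M −ₘ X) ∪ₘ B)   ≡⟨ ∪ₘ-assoc (X −ₘ A) (M −ₘ X) B ⟨
  ((X −ₘ A) ∪ₘ (M −ₘ X)) ∪ₘ B   ≡⟨ cong (_∪ₘ B) ([X−ₘA]∪ₘ[M−ₘX]≡M−ₘA A⊆X X⊆M) ⟩
  (M −ₘ A) ∪ₘ B                 ∎
  where open ≡-Reasoning

reduct-∪ₘ : ∀ K → A ⊆ₘ M → (M ∪ₘ K) [ A ↦ B ] ≡ (M [ A ↦ B ]) ∪ₘ K
reduct-∪ₘ {M = M} K A⊆M = begin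
  (M ∪ₘ K) [ _ ↦ _ ]                 ≡⟨ reduct-∪ₘ-complement A⊆M (M⊆ₘM∪ₘN M K) ⟨
  (M [ _ ↦ _ ]) ∪ₘ ((M ∪ₘ K) −ₘ M)   ≡⟨ cong ((M [ _ ↦ _ ]) ∪ₘ_) (∪ₘ-−ₘ-cancelˡ M K) ⟩
  (M [ _ ↦ _ ]) ∪ₘ K                 ∎
  where open ≡-Reasoning

M⊆ₘM⊔ₘN : ∀ (M N : Multiset n) → M ⊆ₘ M ⊔ₘ N
M⊆ₘM⊔ₘN []      []      = []
M⊆ₘM⊔ₘN (x ∷ M) (y ∷ N) =
  subst (x ≤_) (sym (m+n∸m⊓n≡m⊔n x y)) (m≤m⊔n x y) ∷ M⊆ₘM⊔ₘN M N

N⊆ₘM⊔ₘN : ∀ (M N : Multiset n) → N ⊆ₘ M ⊔ₘ N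
N⊆ₘM⊔ₘN []      []      = []
N⊆ₘM⊔ₘN (x ∷ M) (y ∷ N) =
  subst (y ≤_) (sym (m+n∸m⊓n≡m⊔n x y)) (m≤n⊔m x y) ∷ N⊆ₘM⊔ₘN M N

⊔ₘ-lub : A ⊆ₘ M → B ⊆ₘ M → A ⊔ₘ B ⊆ₘ M
⊔ₘ-lub {A = []}    {B = []}    []            []            = []
⊔ₘ-lub {A = x ∷ A} {B = y ∷ B} (x≤m ∷ A⊆M) (y≤m ∷ B⊆M) =
  subst (_≤ _) (sym (m+n∸m⊓n≡m⊔n x y)) (⊔-lub x≤m y≤m) ∷ ⊔ₘ-lub A⊆M B⊆M

NonEmpty-mono : A ⊆ₘ M → NonEmpty A → NonEmpty M
NonEmpty-mono (x≤m ∷ _)   (here 1≤x) = here (≤-trans 1≤x x≤m)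
NonEmpty-mono (_   ∷ A⊆M) (there ne) = there (NonEmpty-mono A⊆M ne)

⟦⟧-⊆ₘ : a ∈ₘ M → ⟦ a ⟧ ⊆ₘ M
⟦⟧-⊆ₘ {a = a} {M = M} a∈M = ⊆ₘ-lookup⁻ bound
  where
  bound : ∀ i → lookup ⟦ a ⟧ i ≤ lookup M i
  bound i with i ≟ a
  ... | yes refl = ≤-trans (≤-reflexive (lookup-⟦⟧-≡ a)) a∈M
  ... | no i≢a   = ≤-trans (≤-reflexive (lookup-⟦⟧-≢ i≢a)) z≤n

∪ₘ-⟦⟧-⊆ₘ : A ⊆ₘ M → lookup A a < lookup M a → (A ∪ₘ ⟦ a ⟧) ⊆ₘ M
∪ₘ-⟦⟧-⊆ₘ {A = A} {M = M} {a = a} A⊆M Aa<Ma =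
  ⊆ₘ-lookup⁻ λ i → subst (_≤ lookup M i) (sym (lookup-∪ₘ A ⟦ a ⟧ i)) (bound i)
  where
  bound : ∀ i → lookup A i + lookup ⟦ a ⟧ i ≤ lookup M i
  bound i with i ≟ a
  ... | yes refl rewrite lookup-⟦⟧-≡ a | +-comm (lookup A a) 1 = Aa<Ma
  ... | no i≢a   rewrite lookup-⟦⟧-≢ i≢a | +-identityʳ (lookup A i) = Pointwise.lookup A⊆M i

module _ {R : Rules n} where

  joinable-refl : Joinable R M M
  joinable-refl = _ , ε , ε

  joinable-sym : Joinable R M N → Joinable R N M
  joinable-sym (P , M↠P , N↠P) = P , N↠P , M↠P

  step-∪ₘ : ∀ K → Step R M N → Step R (M ∪ₘ K) (N ∪ₘ K)
  step-∪ₘ {M = M} K (rule A↦B A⊆M) =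
    subst (Step R (M ∪ₘ K)) (reduct-∪ₘ K A⊆M) (rule A↦B (⊆ₘ-trans A⊆M (M⊆ₘM∪ₘN M K)))
  step-∪ₘ {M = M} K (idem a 2≤Ma) =
    subst (Step R (M ∪ₘ K)) (∪ₘ-−ₘ-comm K (⟦⟧-⊆ₘ (≤-trans (s≤s z≤n) 2≤Ma)))
      (idem a (≤-trans 2≤Ma (Pointwise.lookup (M⊆ₘM∪ₘN M K) a)))

  joinable-∪ₘ : ∀ K → Joinable R M N → Joinable R (M ∪ₘ K) (N ∪ₘ K)
  joinable-∪ₘ K (P , M↠P , N↠P) =
    P ∪ₘ K , gmap (_∪ₘ K) (step-∪ₘ K) M↠P , gmap (_∪ₘ K) (step-∪ₘ K) N↠P

  rule-rule-peak : CriticalPairsJoinable R → ∀ {A₁ A₂ B₁ B₂} → (A₁ , A₂) ∈ R → (B₁ , B₂) ∈ R →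
    A₁ ⊆ₘ M → B₁ ⊆ₘ M → Joinable R (M [ A₁ ↦ A₂ ]) (M [ B₁ ↦ B₂ ])
  rule-rule-peak {M = M} cp {A₁} {A₂} {B₁} {B₂} A₁↦A₂ B₁↦B₂ A₁⊆M B₁⊆M
    with Product.≡-dec (Vec.≡-dec ℕ._≟_) (Vec.≡-dec ℕ._≟_) (A₁ , A₂) (B₁ , B₂)
  ... | yes refl = joinable-refl
  ... | no A₁↦A₂≢B₁↦B₂ =
    subst₂ (Joinable R)
      (reduct-∪ₘ-complement (M⊆ₘM⊔ₘN A₁ B₁) AB⊆M) (reduct-∪ₘ-complement (N⊆ₘM⊔ₘN A₁ B₁) AB⊆M)
      (joinable-∪ₘ (M −ₘ (A₁ ⊔ₘ B₁)) (cp A₁ A₂ B₁ B₂ A₁↦A₂ B₁↦B₂ A₁↦A₂≢B₁↦B₂))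
    where
    AB⊆M : A₁ ⊔ₘ B₁ ⊆ₘ M
    AB⊆M = ⊔ₘ-lub A₁⊆M B₁⊆M

  rule-idem-disjoint-peak : (A , B) ∈ R → (A ∪ₘ ⟦ a ⟧) ⊆ₘ M → lookup A a ≡ 0 → 2 ≤ lookup M a →
    Joinable R (M [ A ↦ B ]) (M −ₘ ⟦ a ⟧)
  rule-idem-disjoint-peak {A = A} {B = B} {a = a} {M = M} A↦B A∪a⊆M Aa≡0 2≤Ma =
    (M −ₘ ⟦ a ⟧) [ A ↦ B ] , subst (Step R _) idem-then-rule (idem a 2≤Ma[A↦B]) ◅ ε ,
                             rule A↦B (∪ₘ-⊆ₘ⇒⊆ₘ-−ₘ A∪a⊆M) ◅ ε
    where
    2≤Ma[A↦B] : 2 ≤ lookup (M [ A ↦ B ]) a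
    2≤Ma[A↦B] = begin
      2                          ≤⟨ 2≤Ma ⟩
      lookup M a                 ≡⟨ cong (lookup M a ∸_) Aa≡0 ⟨
      lookup M a ∸ lookup A a    ≡⟨ lookup-−ₘ M A a ⟨
      lookup (M −ₘ A) a          ≤⟨ Pointwise.lookup (M⊆ₘM∪ₘN (M −ₘ A) B) a ⟩
      lookup (M [ A ↦ B ]) a     ∎
      where open ≤-Reasoning
    idem-then-rule : (M [ A ↦ B ]) −ₘ ⟦ a ⟧ ≡ (M −ₘ ⟦ a ⟧) [ A ↦ B ]
    idem-then-rule = begin
      ((M −ₘ A) ∪ₘ B) −ₘ ⟦ a ⟧   ≡⟨ ∪ₘ-−ₘ-comm B (∪ₘ-⊆ₘ⇒⊆ₘ-−ₘ′ A∪a⊆M) ⟩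
      ((M −ₘ A) −ₘ ⟦ a ⟧) ∪ₘ B   ≡⟨ cong (_∪ₘ B) (−ₘ-swap M A ⟦ a ⟧) ⟩
      ((M −ₘ ⟦ a ⟧) −ₘ A) ∪ₘ B   ∎
      where open ≡-Reasoning

  rule-idem-overlapping-peak : IdemPairsJoinable R → (A , B) ∈ R → (A ∪ₘ ⟦ a ⟧) ⊆ₘ M → a ∈ₘ A →
    Joinable R (M [ A ↦ B ]) (M −ₘ ⟦ a ⟧)
  rule-idem-overlapping-peak {A = A} {B = B} {a = a} {M = M} ip A↦B A∪a⊆M a∈A =
    joinable-sym
      (subst₂ (Joinable R) left right (joinable-∪ₘ ((M −ₘ ⟦ a ⟧) −ₘ A) (ip A B A↦B a a∈A)))
    where
    left : A ∪ₘ ((M −ₘ ⟦ a ⟧) −ₘ A) ≡ M −ₘ ⟦ a ⟧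
    left = A∪ₘ[M−ₘA]≡M (∪ₘ-⊆ₘ⇒⊆ₘ-−ₘ A∪a⊆M)
    right : (B ∪ₘ ⟦ a ⟧) ∪ₘ ((M −ₘ ⟦ a ⟧) −ₘ A) ≡ M [ A ↦ B ]
    right = begin
      (B ∪ₘ ⟦ a ⟧) ∪ₘ ((M −ₘ ⟦ a ⟧) −ₘ A)   ≡⟨ ∪ₘ-assoc B ⟦ a ⟧ _ ⟩
      B ∪ₘ (⟦ a ⟧ ∪ₘ ((M −ₘ ⟦ a ⟧) −ₘ A))   ≡⟨ cong (λ K → B ∪ₘ (⟦ a ⟧ ∪ₘ K)) (−ₘ-swap M ⟦ a ⟧ A) ⟩
      B ∪ₘ (⟦ a ⟧ ∪ₘ ((M −ₘ A) −ₘ ⟦ a ⟧))   ≡⟨ cong (B ∪ₘ_) (A∪ₘ[M−ₘA]≡M (∪ₘ-⊆ₘ⇒⊆ₘ-−ₘ′ A∪a⊆M)) ⟩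
      B ∪ₘ (M −ₘ A)                         ≡⟨ ∪ₘ-comm B (M −ₘ A) ⟩
      (M −ₘ A) ∪ₘ B                         ∎
      where open ≡-Reasoning

  rule-idem-peak : WellFormed R → IdemPairsJoinable R → (A , B) ∈ R → A ⊆ₘ M → 2 ≤ lookup M a →
    Joinable R (M [ A ↦ B ]) (M −ₘ ⟦ a ⟧)
  rule-idem-peak {A = A} {B = B} {M = M} {a = a} wf ip A↦B A⊆M 2≤Ma = peak (n≤1⇒n≡0∨n≡1 Aa≤1)
    where
    Aa≤1 : lookup A a ≤ 1
    Aa≤1 = lookup⁺ (proj₂ (proj₁ (wf A B A↦B))) a
    A∪a⊆M : (A ∪ₘ ⟦ a ⟧) ⊆ₘ M
    A∪a⊆M = ∪ₘ-⟦⟧-⊆ₘ A⊆M (≤-trans (s≤s Aa≤1) 2≤Ma)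
    peak : lookup A a ≡ 0 ⊎ lookup A a ≡ 1 → Joinable R (M [ A ↦ B ]) (M −ₘ ⟦ a ⟧)
    peak (inj₁ Aa≡0) = rule-idem-disjoint-peak A↦B A∪a⊆M Aa≡0 2≤Ma
    peak (inj₂ Aa≡1) = rule-idem-overlapping-peak ip A↦B A∪a⊆M (≤-reflexive (sym Aa≡1))

  idem-idem-peak : 2 ≤ lookup M a → 2 ≤ lookup M b → Joinable R (M −ₘ ⟦ a ⟧) (M −ₘ ⟦ b ⟧)
  idem-idem-peak {M = M} {a = a} {b = b} 2≤Ma 2≤Mb with a ≟ b
  ... | yes refl = joinable-refl
  ... | no a≢b =
    (M −ₘ ⟦ a ⟧) −ₘ ⟦ b ⟧ ,
    idem b 2≤[M−a]b ◅ ε ,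
    subst (Step R _) (−ₘ-swap M ⟦ b ⟧ ⟦ a ⟧) (idem a 2≤[M−b]a) ◅ ε
    where
    2≤[M−a]b : 2 ≤ lookup (M −ₘ ⟦ a ⟧) b
    2≤[M−a]b = subst (2 ≤_) (sym (lookup-−ₘ-⟦⟧-≢ {M = M} (a≢b ∘ sym))) 2≤Mb
    2≤[M−b]a : 2 ≤ lookup (M −ₘ ⟦ b ⟧) a
    2≤[M−b]a = subst (2 ≤_) (sym (lookup-−ₘ-⟦⟧-≢ {M = M} a≢b)) 2≤Ma

  critical-pairs-joinable : WellFormed R → LocallyConfluent R → CriticalPairsJoinable R
  critical-pairs-joinable wf lc A₁ A₂ B₁ B₂ A₁↦A₂ B₁↦B₂ _ =
    lc (A₁ ⊔ₘ B₁) (NonEmpty-mono (M⊆ₘM⊔ₘN A₁ B₁) (proj₁ (proj₁ (wf A₁ A₂ A₁↦A₂)))) _ _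
      (rule A₁↦A₂ (M⊆ₘM⊔ₘN A₁ B₁)) (rule B₁↦B₂ (N⊆ₘM⊔ₘN A₁ B₁))

  idem-pairs-joinable : WellFormed R → LocallyConfluent R → IdemPairsJoinable R
  idem-pairs-joinable wf lc M N M↦N a a∈M =
    lc (M ∪ₘ ⟦ a ⟧) (NonEmpty-mono M⊆M∪a (proj₁ (proj₁ (wf M N M↦N)))) _ _
      (subst (Step R _) (∪ₘ-−ₘ-cancelʳ M ⟦ a ⟧) (idem a 2≤[M∪a]a))
      (subst (Step R _) rule-reduct (rule M↦N M⊆M∪a))
    where
    M⊆M∪a : M ⊆ₘ (M ∪ₘ ⟦ a ⟧)
    M⊆M∪a = M⊆ₘM∪ₘN M ⟦ a ⟧
    2≤[M∪a]a : 2 ≤ lookup (M ∪ₘ ⟦ a ⟧) a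
    2≤[M∪a]a rewrite lookup-∪ₘ M ⟦ a ⟧ a | lookup-⟦⟧-≡ a = +-monoˡ-≤ 1 a∈M
    rule-reduct : (M ∪ₘ ⟦ a ⟧) [ M ↦ N ] ≡ N ∪ₘ ⟦ a ⟧
    rule-reduct = trans (cong (_∪ₘ N) (∪ₘ-−ₘ-cancelˡ M ⟦ a ⟧)) (∪ₘ-comm ⟦ a ⟧ N)

  locally-confluent : WellFormed R → CriticalPairsJoinable R → IdemPairsJoinable R →
    LocallyConfluent R
  locally-confluent wf cp ip M _ _ _ (rule A₁↦A₂ A₁⊆M) (rule B₁↦B₂ B₁⊆M) =
    rule-rule-peak cp A₁↦A₂ B₁↦B₂ A₁⊆M B₁⊆M
  locally-confluent wf cp ip M _ _ _ (rule A↦B A⊆M) (idem a 2≤Ma) =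
    rule-idem-peak wf ip A↦B A⊆M 2≤Ma
  locally-confluent wf cp ip M _ _ _ (idem a 2≤Ma) (rule A↦B A⊆M) =
    joinable-sym (rule-idem-peak wf ip A↦B A⊆M 2≤Ma)
  locally-confluent wf cp ip M _ _ _ (idem a 2≤Ma) (idem b 2≤Mb) =
    idem-idem-peak 2≤Ma 2≤Mb

lemma4p1 : ∀ (n : ℕ) (R : Rules n) → WellFormed R →
    (LocallyConfluent R ⇔ (CriticalPairsJoinable R × IdemPairsJoinable R))
lemma4p1 n R wf = mk⇔
  (λ lc → critical-pairs-joinable wf lc , idem-pairs-joinable wf lc)
  (λ (cp , ip) → locally-confluent wf cp ip)
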